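{- The rule ($\neg$left$^{ -1}$): from $\mathrm{X}^i\neg\alpha,\Gamma\Rightarrow$ (empty succedent) infer $\Gamma\Rightarrow\mathrm{X}^i\alpha$ (for any formula $\alpha$, natural number $i$, finite set of formulas $\Gamma$) is derivable in cut-free $\mathrm{SLT}_{\omega}$, i.e. there is a derivation in $\mathrm{SLT}_{\omega}$ without (cut) of $\Gamma\Rightarrow\mathrm{X}^i\alpha$ from the premise $\mathrm{X}^i\neg\alpha,\Gamma\Rightarrow$.
   Context: Formulas are built from countably many propositional variables using binary $\to,\wedge,\vee$ and unary $\neg,\mathrm{G},\mathrm{F},\mathrm{X}$; $\mathrm{X}^0\alpha:=\alpha$, $\mathrm{X}^{n+1}\alpha:=\mathrm{X}^n\mathrm{X}\alpha$. $\Gamma$ denotes a finite set of formulas; commas denote union. Sequents of $\mathrm{SLT}_{\omega}$ are $\Gamma\Rightarrow\gamma$ with $\gamma$ a formula or empty; derivations are well-founded, possibly infinitely branching trees. Cut-free $\mathrm{SLT}_{\omega}$ has, with $i,k$ arbitrary natural numbers and $p$ a propositional variable: initial sequents $\mathrm{X}^ip,\Gamma\Rightarrow\mathrm{X}^ip$; (we-right) from $\Gamma\Rightarrow$ infer $\Gamma\Rightarrow\alpha$; ($\to$left) from $\Gamma\Rightarrow\mathrm{X}^i\alpha$ and $\mathrm{X}^i\beta,\Gamma\Rightarrow\gamma$ infer $\mathrm{X}^i(\alpha\to\beta),\Gamma\Rightarrow\gamma$; ($\to$right) from $\mathrm{X}^i\alpha,\Gamma\Rightarrow\mathrm{X}^i\beta$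 infer $\Gamma\Rightarrow\mathrm{X}^i(\alpha\to\beta)$; ($\neg$left) from $\Gamma\Rightarrow\mathrm{X}^i\alpha$ infer $\mathrm{X}^i\neg\alpha,\Gamma\Rightarrow$; ($\neg$right) from $\mathrm{X}^i\alpha,\Gamma\Rightarrow$ infer $\Gamma\Rightarrow\mathrm{X}^i\neg\alpha$; (ex-middle) from $\mathrm{X}^i\neg\alpha,\Gamma\Rightarrow\gamma$ and $\mathrm{X}^i\alpha,\Gamma\Rightarrow\gamma$ infer $\Gamma\Rightarrow\gamma$; ($\wedge$left) from $\mathrm{X}^i\alpha,\mathrm{X}^i\beta,\Gamma\Rightarrow\gamma$ infer $\mathrm{X}^i(\alpha\wedge\beta),\Gamma\Rightarrow\gamma$; ($\wedge$right) from $\Gamma\Rightarrow\mathrm{X}^i\alpha$ and $\Gamma\Rightarrow\mathrm{X}^i\beta$ infer $\Gamma\Rightarrow\mathrm{X}^i(\alpha\wedge\beta)$; ($\vee$left) from $\mathrm{X}^i\alpha,\Gamma\Rightarrow\gamma$ and $\mathrm{X}^i\beta,\Gamma\Rightarrow\gamma$ infer $\mathrm{X}^i(\alpha\vee\beta),\Gamma\Rightarrow\gamma$; ($\vee$right1/2) from $\Gamma\Rightarrow\mathrm{X}^i\alpha$ (resp. $\Gamma\Rightarrow\mathrm{X}^i\beta$) infer $\Gamma\Rightarrow\mathrm{X}^i(\alpha\vee\beta)$; (Gleft) from $\mathrm{X}^{i+k}\alpha,\Gamma\Rightarrow\gamma$ infer $\mathrm{X}^i\mathrm{G}\alpha,\Gamma\Rightarrow\gamma$;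 (Gright) from all $\Gamma\Rightarrow\mathrm{X}^{i+j}\alpha$ ($j\in\omega$) infer $\Gamma\Rightarrow\mathrm{X}^i\mathrm{G}\alpha$; (Fleft) from all $\mathrm{X}^{i+j}\alpha,\Gamma\Rightarrow\gamma$ ($j\in\omega$) infer $\mathrm{X}^i\mathrm{F}\alpha,\Gamma\Rightarrow\gamma$; (Fright) from $\Gamma\Rightarrow\mathrm{X}^{i+k}\alpha$ infer $\Gamma\Rightarrow\mathrm{X}^i\mathrm{F}\alpha$. -}

module Defs where

open import Data.Nat using (ℕ; zero; suc; _+_)
open import Data.List using (List; _∷_)
open import Data.List.Relation.Binary.Subset.Propositional using (_⊆_)
open import Data.Maybe using (Maybe; just; nothing)
open import Data.Product using (_×_)
open import Relation.Binary.PropositionalEquality using (_≡_)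

infixr 5 _⊃_
infixr 6 _∨_
infixr 7 _∧_

data Formula : Set where
  var : ℕ → Formula
  _⊃_ : Formula → Formula → Formula
  _∧_ : Formula → Formula → Formula
  _∨_ : Formula → Formula → Formula
  ¬_  : Formula → Formula
  G   : Formula → Formula
  F   : Formula → Formula
  X   : Formula → Formula

X^ : ℕ → Formula → Formula
X^ zero    α = α
X^ (suc n) α = X^ n (X α)

-- Antecedents: finite sets of formulas, represented as lists taken up to
-- set equality (same elements); the rule `set-eq` below realises this.
Ctx : Set
Ctx = List Formula

_≈set_ : Ctx → Ctx → Set
Γ ≈set Δ = (Γ ⊆ Δ) × (Δ ⊆ Γ)

Succ : Set
Succ = Maybe Formula

-- Sets of sequents that may be used as (open) leaves / assumptions.
Hyps : Set₁
Hyps = Ctx → Succ → Set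

-- Derivations of cut-free SLT_ω from assumptions H (well-founded, possibly
-- infinitely branching trees).  `Der H Γ γ` : there is a derivation without
-- (cut) of the sequent Γ ⇒ γ whose leaves are initial sequents or sequents in H.
data Der (H : Hyps) : Ctx → Succ → Set where
  hyp      : ∀ {Γ γ} → H Γ γ → Der H Γ γ
  set-eq   : ∀ {Γ Δ γ} → Γ ≈set Δ → Der H Γ γ → Der H Δ γ
  init     : ∀ {Γ} i p → Der H (X^ i (var p) ∷ Γ) (just (X^ i (var p)))
  we-right : ∀ {Γ} α → Der H Γ nothing → Der H Γ (just α)
  ⊃left    : ∀ {Γ γ} i α β → Der H Γ (just (X^ i α)) → Der H (X^ i β ∷ Γ) γ
           → Der H (X^ i (α ⊃ β) ∷ Γ) γ
  ⊃right   : ∀ {Γ} i α β → Der H (X^ i α ∷ Γ) (just (X^ i β))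
           → Der H Γ (just (X^ i (α ⊃ β)))
  ¬left    : ∀ {Γ} i α → Der H Γ (just (X^ i α)) → Der H (X^ i (¬ α) ∷ Γ) nothing
  ¬right   : ∀ {Γ} i α → Der H (X^ i α ∷ Γ) nothing → Der H Γ (just (X^ i (¬ α)))
  ex-middle : ∀ {Γ γ} i α → Der H (X^ i (¬ α) ∷ Γ) γ → Der H (X^ i α ∷ Γ) γ
            → Der H Γ γ
  ∧left    : ∀ {Γ γ} i α β → Der H (X^ i α ∷ X^ i β ∷ Γ) γ
           → Der H (X^ i (α ∧ β) ∷ Γ) γ
  ∧right   : ∀ {Γ} i α β → Der H Γ (just (X^ i α)) → Der H Γ (just (X^ i β))
           → Der H Γ (just (X^ i (α ∧ β)))
  ∨left    : ∀ {Γ γ} i α β → Der H (X^ i α ∷ Γ) γ → Der H (X^ i β ∷ Γ) γ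
           → Der H (X^ i (α ∨ β) ∷ Γ) γ
  ∨right1  : ∀ {Γ} i α β → Der H Γ (just (X^ i α)) → Der H Γ (just (X^ i (α ∨ β)))
  ∨right2  : ∀ {Γ} i α β → Der H Γ (just (X^ i β)) → Der H Γ (just (X^ i (α ∨ β)))
  Gleft    : ∀ {Γ γ} i k α → Der H (X^ (i + k) α ∷ Γ) γ → Der H (X^ i (G α) ∷ Γ) γ
  Gright   : ∀ {Γ} i α → ((j : ℕ) → Der H Γ (just (X^ (i + j) α)))
           → Der H Γ (just (X^ i (G α)))
  Fleft    : ∀ {Γ γ} i α → ((j : ℕ) → Der H (X^ (i + j) α ∷ Γ) γ)
           → Der H (X^ i (F α) ∷ Γ) γ
  Fright   : ∀ {Γ} i k α → Der H Γ (just (X^ (i + k) α)) → Der H Γ (just (X^ i (F α)))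

Only : Ctx → Succ → Hyps
Only Δ δ Θ θ = (Θ ≡ Δ) × (θ ≡ δ)

{-# OPTIONS --safe #-}
module Submission where

-- The premise Xⁱ¬α, Γ ⇒ yields Γ ⇒ Xⁱα by weakening on the right, and the
-- generalised initial sequent Xⁱα, Γ ⇒ Xⁱα (derivable for every formula by
-- induction on α) covers the other branch; (ex-middle) on Xⁱα joins the two.

open import Defs
open import Data.Nat using (ℕ; suc; _+_)
open import Data.List using (_∷_)
open import Data.List.Relation.Binary.Permutation.Propositional
  using (_↭_; ↭-sym; ↭-refl; ↭-swap)
open import Data.List.Relation.Binary.Subset.Propositional.Properties
  using (⊆-reflexive-↭)
open import Data.Maybe using (just; nothing)
open import Data.Product using (_,_)
open import Relation.Binary.PropositionalEquality using (refl)

↭⇒≈set : ∀ {Γ Δ} → Γ ↭ Δ → Γ ≈set Δ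
↭⇒≈set Γ↭Δ = ⊆-reflexive-↭ Γ↭Δ , ⊆-reflexive-↭ (↭-sym Γ↭Δ)

exchange : ∀ {H α β Γ γ} → Der H (α ∷ β ∷ Γ) γ → Der H (β ∷ α ∷ Γ) γ
exchange = set-eq (↭⇒≈set (↭-swap _ _ ↭-refl))

identity : ∀ {H} i α Γ → Der H (X^ i α ∷ Γ) (just (X^ i α))
identity i (var p) Γ = init i p
identity i (α ⊃ β) Γ =
  ⊃right i α β (exchange (⊃left i α β (identity i α Γ) (identity i β _)))
identity i (α ∧ β) Γ =
  ∧right i α β (∧left i α β (identity i α _)) (∧left i α β (exchange (identity i β _)))
identity i (α ∨ β) Γ =
  ∨left i α β (∨right1 i α β (identity i α Γ)) (∨right2 i α β (identity i β Γ))
identity i (¬ α) Γ = ¬right i α (exchange (¬left i α (identity i α Γ)))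
identity i (G α) Γ = Gright i α (λ j → Gleft i j α (identity (i + j) α Γ))
identity i (F α) Γ = Fleft i α (λ j → Fright i j α (identity (i + j) α Γ))
-- X^ (suc i) α reduces to X^ i (X α), so this is a structurally smaller instance.
identity i (X α) Γ = identity (suc i) α Γ

¬left⁻¹ : ∀ {H} i α Γ → Der H (X^ i (¬ α) ∷ Γ) nothing → Der H Γ (just (X^ i α))
¬left⁻¹ i α Γ premise = ex-middle i α (we-right _ premise) (identity i α Γ)

proposition3 : (α : Formula) (i : ℕ) (Γ : Ctx)
    → Der (Only (X^ i (¬ α) ∷ Γ) nothing) Γ (just (X^ i α))
proposition3 α i Γ = ¬left⁻¹ i α Γ (hyp (refl , refl))
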